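{- Let $(a_{ij})$, indexed by ordered pairs $i\ne j$ in $\{2,3,4,5\}$, be complex numbers satisfying (i) $a_{ij}+a_{jk}+a_{km}=a_{ik}+a_{kj}+a_{jm}$ whenever $\{i,j,k,m\}=\{2,3,4,5\}$, and (ii) $a_{ij}+a_{jk}=a_{ij'}+a_{j'k}$ whenever $\{i,j,k,j'\}=\{2,3,4,5\}$. Then there exists $\lambda\in\mathbb{C}$ such that for every permutation $\mu$ of $\{2,3,4,5\}$ moving exactly $l$ elements, $\sum_{2\le i\le5,\ \mu(i)\ne i}a_{i\mu(i)}=l\lambda$. -}

module Defs where

open import Level using (Level; _⊔_)
open import Data.Nat using (ℕ; zero; suc)
open import Data.Fin using (Fin)
open import Data.Fin.Permutation using (Permutation′; _⟨$⟩ʳ_)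
open import Data.List using (List; foldr; allFin)
open import Data.Fin.Properties using (_≟_)
open import Data.Product using (Σ) renaming (_×_ to _∧_)
open import Relation.Nullary using (¬_; yes; no)
open import Relation.Binary.PropositionalEquality using (_≢_)
open import Algebra.Bundles using (CommutativeRing; Semiring)
import Algebra.Definitions.RawSemiring as RS

scale : {c ℓ : Level} (R : CommutativeRing c ℓ) → ℕ → CommutativeRing.Carrier R → CommutativeRing.Carrier R
scale R = RS._×_ (Semiring.rawSemiring (CommutativeRing.semiring R))

record IsCharZeroField {c ℓ : Level} (R : CommutativeRing c ℓ) : Set (c ⊔ ℓ) where
  open CommutativeRing R
  field
    1≉0     : ¬ (1# ≈ 0#)
    inverse : ∀ x → ¬ (x ≈ 0#) → Σ Carrier λ y → (x * y) ≈ 1#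
    charZero : ∀ n → ¬ ((scale R (suc n) 1#) ≈ 0#)

-- Four pairwise distinct indices in Fin 4, i.e. {i,j,k,m} is the whole set.
Distinct4 : Fin 4 → Fin 4 → Fin 4 → Fin 4 → Set
Distinct4 i j k m =
  (i ≢ j) ∧ (i ≢ k) ∧ (i ≢ m) ∧ (j ≢ k) ∧ (j ≢ m) ∧ (k ≢ m)

module _ {c ℓ : Level} (R : CommutativeRing c ℓ) where
  open CommutativeRing R

  movedSum : (Fin 4 → Fin 4 → Carrier) → Permutation′ 4 → Carrier
  movedSum a μ = foldr step 0# (allFin 4)
    where
    step : Fin 4 → Carrier → Carrier
    step i acc with (μ ⟨$⟩ʳ i) ≟ i
    ... | yes _ = acc
    ... | no  _ = a i (μ ⟨$⟩ʳ i) + acc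

  movedCount : Permutation′ 4 → ℕ
  movedCount μ = foldr step 0 (allFin 4)
    where
    step : Fin 4 → ℕ → ℕ
    step i acc with (μ ⟨$⟩ʳ i) ≟ i
    ... | yes _ = acc
    ... | no  _ = suc acc

-- Conditions (i) and (ii) force a i j + a j k ≈ κ + a i k for all distinct
-- i, j, k and one constant κ: (ii) lets the middle vertex of a two-step path
-- be changed, (i) lets a triangle be rotated, and these moves reach every
-- triangle that is needed from the one defining κ. The triangle law makes
-- a i j − κ a coboundary f i − f j, and along a permutation μ the sum of
-- f i − f (μ i) over the moved points telescopes to zero, leaving l · κ.
-- No division is used: the statement holds over any commutative ring.
module Submission where

open import Defs
open import Level using (Level)
open import Data.Fin using (Fin; suc)
open import Data.Fin.Patterns using (0F; 1F; 2F; 3F)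
open import Data.Fin.Properties using (_≟_)
open import Data.Fin.Permutation using (Permutation′; _⟨$⟩ʳ_)
open import Data.List using (List; _∷_; foldr; allFin)
open import Data.List.Relation.Unary.All using (All; []; _∷_)
open import Data.Nat using (ℕ; suc)
open import Data.Product using (Σ; _,_)
open import Function using (_∘_)
open import Relation.Binary.PropositionalEquality using (_≡_; _≢_)
import Relation.Binary.PropositionalEquality as Eq
open import Relation.Nullary using (Dec; yes; no; ¬?; _×-dec_; contradiction)
open import Relation.Nullary.Decidable using (True; toWitness)
open import Algebra.Bundles using (CommutativeRing)
import Algebra.Properties.CommutativeMonoid.Sum as CommutativeMonoidSum
import Algebra.Properties.CommutativeSemigroup as CommutativeSemigroupProperties
import Algebra.Properties.Group as GroupProperties
import Relation.Binary.Reasoning.Setoid as SetoidReasoning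

distinct4? : ∀ i j k m → Dec (Distinct4 i j k m)
distinct4? i j k m =
  ¬? (i ≟ j) ×-dec ¬? (i ≟ k) ×-dec ¬? (i ≟ m) ×-dec
  ¬? (j ≟ k) ×-dec ¬? (j ≟ m) ×-dec ¬? (k ≟ m)

module _ {r ℓ : Level} (R : CommutativeRing r ℓ) where
  open CommutativeRing R
  open CommutativeSemigroupProperties +-commutativeSemigroup using (interchange; x∙yz≈y∙xz; xy∙z≈y∙xz)
  open GroupProperties +-group using (∙-cancelˡ; ∙-cancelʳ; //-rightDividesˡ)
  open CommutativeMonoidSum +-commutativeMonoid using (sum; sum-permute)
  open SetoidReasoning setoid

  sumOver : (Fin 4 → Carrier) → List (Fin 4) → Carrier
  sumOver f = foldr (λ i s → f i + s) 0#

  module _ (μ : Permutation′ 4) where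

    -- On allFin 4 these are exactly the decisions movedSum and movedCount
    -- branch on.
    FixedPointDecisions : List (Fin 4) → Set
    FixedPointDecisions = All (λ i → Dec (μ ⟨$⟩ʳ i ≡ i))

    movedSumOver : (a : Fin 4 → Fin 4 → Carrier) → ∀ {xs} → FixedPointDecisions xs → Carrier
    movedSumOver a []                   = 0#
    movedSumOver a (yes _ ∷ ds)         = movedSumOver a ds
    movedSumOver a {i ∷ _} (no _ ∷ ds)  = a i (μ ⟨$⟩ʳ i) + movedSumOver a ds

    movedCountOver : ∀ {xs} → FixedPointDecisions xs → ℕ
    movedCountOver []           = 0
    movedCountOver (yes _ ∷ ds) = movedCountOver ds
    movedCountOver (no _ ∷ ds)  = suc (movedCountOver ds)

  module _ (a : Fin 4 → Fin 4 → Carrier) (f : Fin 4 → Carrier) (κ : Carrier)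
           (isCoboundary : ∀ i j → i ≢ j → a i j + f j ≈ κ + f i) where

    movedSumOver-telescopes : ∀ μ {xs} (ds : FixedPointDecisions μ xs) →
      movedSumOver μ a ds + sumOver (f ∘ (μ ⟨$⟩ʳ_)) xs ≈
      scale R (movedCountOver μ ds) κ + sumOver f xs
    movedSumOver-telescopes μ [] = refl
    movedSumOver-telescopes μ {i ∷ xs} (yes μi≡i ∷ ds) = begin
      M + (f (μ ⟨$⟩ʳ i) + Sμ) ≈⟨ x∙yz≈y∙xz _ _ _ ⟩
      f (μ ⟨$⟩ʳ i) + (M + Sμ) ≡⟨ Eq.cong (λ x → f x + (M + Sμ)) μi≡i ⟩
      f i + (M + Sμ)          ≈⟨ +-congˡ (movedSumOver-telescopes μ ds) ⟩
      f i + (scale R n κ + S) ≈⟨ x∙yz≈y∙xz _ _ _ ⟩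
      scale R n κ + (f i + S) ∎
      where
      M  = movedSumOver μ a ds
      Sμ = sumOver (f ∘ (μ ⟨$⟩ʳ_)) xs
      S  = sumOver f xs
      n  = movedCountOver μ ds
    movedSumOver-telescopes μ {i ∷ xs} (no μi≢i ∷ ds) = begin
      (a i (μ ⟨$⟩ʳ i) + M) + (f (μ ⟨$⟩ʳ i) + Sμ) ≈⟨ interchange _ _ _ _ ⟩
      (a i (μ ⟨$⟩ʳ i) + f (μ ⟨$⟩ʳ i)) + (M + Sμ) ≈⟨ +-cong (isCoboundary i (μ ⟨$⟩ʳ i) (μi≢i ∘ Eq.sym))
                                                            (movedSumOver-telescopes μ ds) ⟩
      (κ + f i) + (scale R n κ + S)               ≈⟨ interchange _ _ _ _ ⟩
      (κ + scale R n κ) + (f i + S)               ∎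
      where
      M  = movedSumOver μ a ds
      Sμ = sumOver (f ∘ (μ ⟨$⟩ʳ_)) xs
      S  = sumOver f xs
      n  = movedCountOver μ ds

    -- μ permutes allFin 4, so the two sums of f cancel.
    movedSumOver-coboundary : ∀ μ (ds : FixedPointDecisions μ (allFin 4)) →
      movedSumOver μ a ds ≈ scale R (movedCountOver μ ds) κ
    movedSumOver-coboundary μ ds = ∙-cancelʳ (sum (f ∘ (μ ⟨$⟩ʳ_))) _ _
      (trans (movedSumOver-telescopes μ ds) (+-congˡ (sum-permute f μ)))

    -- movedSum and movedCount branch by `with`, so they only compute once
    -- every decision is a constructor.
    movedSum-coboundary : ∀ μ → movedSum R a μ ≈ scale R (movedCount R μ) κ
    movedSum-coboundary μ with μ ⟨$⟩ʳ 0F ≟ 0F | μ ⟨$⟩ʳ 1F ≟ 1F | μ ⟨$⟩ʳ 2F ≟ 2F | μ ⟨$⟩ʳ 3F ≟ 3F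
    ... | d₀@(yes _) | d₁@(yes _) | d₂@(yes _) | d₃@(yes _) = movedSumOver-coboundary μ (d₀ ∷ d₁ ∷ d₂ ∷ d₃ ∷ [])
    ... | d₀@(yes _) | d₁@(yes _) | d₂@(yes _) | d₃@(no _)  = movedSumOver-coboundary μ (d₀ ∷ d₁ ∷ d₂ ∷ d₃ ∷ [])
    ... | d₀@(yes _) | d₁@(yes _) | d₂@(no _)  | d₃@(yes _) = movedSumOver-coboundary μ (d₀ ∷ d₁ ∷ d₂ ∷ d₃ ∷ [])
    ... | d₀@(yes _) | d₁@(yes _) | d₂@(no _)  | d₃@(no _)  = movedSumOver-coboundary μ (d₀ ∷ d₁ ∷ d₂ ∷ d₃ ∷ [])
    ... | d₀@(yes _) | d₁@(no _)  | d₂@(yes _) | d₃@(yes _) = movedSumOver-coboundary μ (d₀ ∷ d₁ ∷ d₂ ∷ d₃ ∷ [])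
    ... | d₀@(yes _) | d₁@(no _)  | d₂@(yes _) | d₃@(no _)  = movedSumOver-coboundary μ (d₀ ∷ d₁ ∷ d₂ ∷ d₃ ∷ [])
    ... | d₀@(yes _) | d₁@(no _)  | d₂@(no _)  | d₃@(yes _) = movedSumOver-coboundary μ (d₀ ∷ d₁ ∷ d₂ ∷ d₃ ∷ [])
    ... | d₀@(yes _) | d₁@(no _)  | d₂@(no _)  | d₃@(no _)  = movedSumOver-coboundary μ (d₀ ∷ d₁ ∷ d₂ ∷ d₃ ∷ [])
    ... | d₀@(no _)  | d₁@(yes _) | d₂@(yes _) | d₃@(yes _) = movedSumOver-coboundary μ (d₀ ∷ d₁ ∷ d₂ ∷ d₃ ∷ [])
    ... | d₀@(no _)  | d₁@(yes _) | d₂@(yes _) | d₃@(no _)  = movedSumOver-coboundary μ (d₀ ∷ d₁ ∷ d₂ ∷ d₃ ∷ [])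
    ... | d₀@(no _)  | d₁@(yes _) | d₂@(no _)  | d₃@(yes _) = movedSumOver-coboundary μ (d₀ ∷ d₁ ∷ d₂ ∷ d₃ ∷ [])
    ... | d₀@(no _)  | d₁@(yes _) | d₂@(no _)  | d₃@(no _)  = movedSumOver-coboundary μ (d₀ ∷ d₁ ∷ d₂ ∷ d₃ ∷ [])
    ... | d₀@(no _)  | d₁@(no _)  | d₂@(yes _) | d₃@(yes _) = movedSumOver-coboundary μ (d₀ ∷ d₁ ∷ d₂ ∷ d₃ ∷ [])
    ... | d₀@(no _)  | d₁@(no _)  | d₂@(yes _) | d₃@(no _)  = movedSumOver-coboundary μ (d₀ ∷ d₁ ∷ d₂ ∷ d₃ ∷ [])
    ... | d₀@(no _)  | d₁@(no _)  | d₂@(no _)  | d₃@(yes _) = movedSumOver-coboundary μ (d₀ ∷ d₁ ∷ d₂ ∷ d₃ ∷ [])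
    ... | d₀@(no _)  | d₁@(no _)  | d₂@(no _)  | d₃@(no _)  = movedSumOver-coboundary μ (d₀ ∷ d₁ ∷ d₂ ∷ d₃ ∷ [])

  module _ (a : Fin 4 → Fin 4 → Carrier) where

    Triangle : Carrier → Fin 4 → Fin 4 → Fin 4 → Set ℓ
    Triangle κ i j k = a i j + a j k ≈ κ + a i k

    SwappableMiddleSteps : Set ℓ
    SwappableMiddleSteps = ∀ i j k m → Distinct4 i j k m →
      (a i j + a j k) + a k m ≈ (a i k + a k j) + a j m

    TwoStepPathsAgree : Set ℓ
    TwoStepPathsAgree = ∀ i j k j′ → Distinct4 i j k j′ →
      a i j + a j k ≈ a i j′ + a j′ k

    module _ {κ : Carrier} {i j k m : Fin 4} (ijkm : Distinct4 i j k m) where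

      Triangle-changeMiddle : TwoStepPathsAgree →
        Triangle κ i j k → Triangle κ i m k
      Triangle-changeMiddle indep ijk = trans (sym (indep i j k m ijkm)) ijk

      Triangle-rotate : SwappableMiddleSteps → Triangle κ i j k → Triangle κ k j m
      Triangle-rotate swap ijk = ∙-cancelˡ (a i k) _ _ (begin
        a i k + (a k j + a j m)   ≈⟨ +-assoc _ _ _ ⟨
        (a i k + a k j) + a j m   ≈⟨ swap i j k m ijkm ⟨
        (a i j + a j k) + a k m   ≈⟨ +-congʳ ijk ⟩
        (κ + a i k) + a k m       ≈⟨ xy∙z≈y∙xz _ _ _ ⟩
        a i k + (κ + a k m)       ∎)

    Triangle⇒twoCycle : ∀ {κ i j k} → Triangle κ i j k → Triangle κ i k j →
      a j k + a k j ≈ κ + κ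
    Triangle⇒twoCycle {κ} {i} {j} {k} ijk ikj = ∙-cancelˡ (a i j + a i k) _ _ (begin
      (a i j + a i k) + (a j k + a k j) ≈⟨ interchange _ _ _ _ ⟩
      (a i j + a j k) + (a i k + a k j) ≈⟨ +-cong ijk ikj ⟩
      (κ + a i k) + (κ + a i j)         ≈⟨ +-comm _ _ ⟩
      (κ + a i j) + (κ + a i k)         ≈⟨ interchange _ _ _ _ ⟩
      (κ + κ) + (a i j + a i k)         ≈⟨ +-comm _ _ ⟩
      (a i j + a i k) + (κ + κ)         ∎)

    module _ (swap : SwappableMiddleSteps) (indep : TwoStepPathsAgree) where

      κ : Carrier
      κ = (a 1F 2F + a 2F 0F) - a 1F 0F

      private
        changeMiddle : ∀ {i j k m} {d : True (distinct4? i j k m)} →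
          Triangle κ i j k → Triangle κ i m k
        changeMiddle {d = d} = Triangle-changeMiddle (toWitness d) indep

        rotate : ∀ {i j k m} {d : True (distinct4? i j k m)} →
          Triangle κ i j k → Triangle κ k j m
        rotate {d = d} = Triangle-rotate (toWitness d) swap

        t120 : Triangle κ 1F 2F 0F
        t120 = sym (//-rightDividesˡ (a 1F 0F) (a 1F 2F + a 2F 0F))

        t130 : Triangle κ 1F 3F 0F
        t130 = changeMiddle t120
        t032 : Triangle κ 0F 3F 2F
        t032 = rotate t130
        t231 : Triangle κ 2F 3F 1F
        t231 = rotate t032
        t201 : Triangle κ 2F 0F 1F
        t201 = changeMiddle t231
        t023 : Triangle κ 0F 2F 3F
        t023 = rotate t120
        t013 : Triangle κ 0F 1F 3F
        t013 = changeMiddle t023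
        t312 : Triangle κ 3F 1F 2F
        t312 = rotate t013
        t302 : Triangle κ 3F 0F 2F
        t302 = changeMiddle t312
        t210 : Triangle κ 2F 1F 0F
        t210 = rotate t312
        t230 : Triangle κ 2F 3F 0F
        t230 = changeMiddle t210
        t012 : Triangle κ 0F 1F 2F
        t012 = changeMiddle t032
        t213 : Triangle κ 2F 1F 3F
        t213 = rotate t012
        t203 : Triangle κ 2F 0F 3F
        t203 = changeMiddle t213
        t310 : Triangle κ 3F 1F 0F
        t310 = rotate t213
        t320 : Triangle κ 3F 2F 0F
        t320 = changeMiddle t310

      potential : Fin 4 → Carrier
      potential 0F         = κ
      potential i@(suc _)  = a i 0F

      coboundary : ∀ i j → i ≢ j → a i j + potential j ≈ κ + potential i
      coboundary 0F 1F _ = Triangle⇒twoCycle t201 t210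
      coboundary 0F 2F _ = Triangle⇒twoCycle t302 t320
      coboundary 0F 3F _ = Triangle⇒twoCycle t203 t230
      coboundary (suc _) 0F _ = +-comm _ _
      coboundary 1F 2F _ = t120
      coboundary 1F 3F _ = t130
      coboundary 2F 1F _ = t210
      coboundary 2F 3F _ = t230
      coboundary 3F 1F _ = t310
      coboundary 3F 2F _ = t320
      coboundary 0F 0F 0≢0 = contradiction Eq.refl 0≢0
      coboundary 1F 1F 1≢1 = contradiction Eq.refl 1≢1
      coboundary 2F 2F 2≢2 = contradiction Eq.refl 2≢2
      coboundary 3F 3F 3≢3 = contradiction Eq.refl 3≢3

lemma4p13 : {c ℓ : Level} (R : CommutativeRing c ℓ) → IsCharZeroField R →
    let open CommutativeRing R in
    (a : Fin 4 → Fin 4 → Carrier) →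
    (∀ i j k m → Distinct4 i j k m →
      ((a i j + a j k) + a k m) ≈ ((a i k + a k j) + a j m)) →
    (∀ i j k j′ → Distinct4 i j k j′ →
      (a i j + a j k) ≈ (a i j′ + a j′ k)) →
    Σ Carrier λ λ₀ → ∀ (μ : Permutation′ 4) →
      movedSum R a μ ≈ scale R (movedCount R μ) λ₀
lemma4p13 R _ a swap indep =
  κ R a swap indep ,
  movedSum-coboundary R a (potential R a swap indep) (κ R a swap indep) (coboundary R a swap indep)
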